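{- For $\boldsymbol\nu=(\nu_1,\nu_2,\nu_3)\in\mathbf N^3$, consider the formal power series in $t_0,t_1,t_2,t_3$ with coefficients in $\mathbf Z[\rho]$ $$G_{\rho,\boldsymbol\nu}(\mathbf t)=\sum_{\mathbf d\in\mathbf N^{\{0,1,2,3\}}}\rho^{\,\min(d_2+\nu_2,d_3+\nu_3)-\left\lceil\frac12\left(\min(d_2+\nu_2,d_3+\nu_3)-\min(d_1+\nu_1,d_2+\nu_2,d_3+\nu_3)\right)\right\rceil}\,t_0^{d_0}t_1^{d_1}t_2^{d_2}t_3^{d_3},$$ where $\lceil x\rceil$ is the least integer $\ge x$, and define $a_{\boldsymbol\nu,\mathbf d}(\rho)\in\mathbf Z[\rho]$ for $\mathbf d=(d_1,d_2,d_3)\in\mathbf N^{\{1,2,3\}}$ by $$\widetilde G_{\rho,\boldsymbol\nu}(\mathbf t):=(1-\rho t_2^2t_3^2)(1-\rho t_1t_2t_3)\prod_{i=0}^3(1-t_i)\,G_{\rho,\boldsymbol\nu}(\mathbf t)=\sum_{\mathbf d\in\mathbf N^{\{1,2,3\}}}a_{\boldsymbol\nu,\mathbf d}(\rho)\,t_1^{d_1}t_2^{d_2}t_3^{d_3}.$$ If one of the conditions $$d_1\ge5+|\nu_2-\nu_1|+|\nu_3-\nu_1|,\quad d_2\ge7+|\nu_1-\nu_2|+|\nu_3-\nu_2|,\quad d_3\ge7+|\nu_1-\nu_3|+|\nu_2-\nu_3|$$ is satisfied, then $a_{\boldsymbol\nu,\mathbf d}(\rho)=0$. In particular $\widetilde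 G_{\rho,\boldsymbol\nu}(\mathbf t)$ is a polynomial. -}

module Defs where

open import Data.Nat using (ℕ; _≤ᵇ_; _≡ᵇ_; _∸_; _⊓_; ⌈_/2⌉)
open import Data.Bool using (Bool; if_then_else_; _∧_)
open import Data.Integer using (ℤ; 0ℤ; 1ℤ; _-_)

-- Formal power series in ρ, t₀, t₁, t₂, t₃ with integer coefficients,
-- given by their coefficient function:
-- f k d₀ d₁ d₂ d₃ = coefficient of ρ^k t₀^d₀ t₁^d₁ t₂^d₂ t₃^d₃.
-- (Coefficients in ℤ[ρ] are thus encoded by their ρ-coefficients.)
Series : Set
Series = ℕ → ℕ → ℕ → ℕ → ℕ → ℤ

mulMono : (a b₀ b₁ b₂ b₃ : ℕ) → Series → Series
mulMono a b₀ b₁ b₂ b₃ f k d₀ d₁ d₂ d₃ =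
  if (a ≤ᵇ k) ∧ (b₀ ≤ᵇ d₀) ∧ (b₁ ≤ᵇ d₁) ∧ (b₂ ≤ᵇ d₂) ∧ (b₃ ≤ᵇ d₃)
  then f (k ∸ a) (d₀ ∸ b₀) (d₁ ∸ b₁) (d₂ ∸ b₂) (d₃ ∸ b₃)
  else 0ℤ

oneMinusMono : (a b₀ b₁ b₂ b₃ : ℕ) → Series → Series
oneMinusMono a b₀ b₁ b₂ b₃ f k d₀ d₁ d₂ d₃ =
  f k d₀ d₁ d₂ d₃ - mulMono a b₀ b₁ b₂ b₃ f k d₀ d₁ d₂ d₃

-- the exponent of ρ:
-- min(d₂+ν₂,d₃+ν₃) - ⌈(min(d₂+ν₂,d₃+ν₃) - min(d₁+ν₁,d₂+ν₂,d₃+ν₃))/2⌉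
-- (all differences are of naturals with nonnegative true value)
expo : (ν₁ ν₂ ν₃ d₁ d₂ d₃ : ℕ) → ℕ
expo ν₁ ν₂ ν₃ d₁ d₂ d₃ =
  m23 ∸ ⌈ (m23 ∸ m123) /2⌉
  where
  open import Data.Nat using (_+_)
  m23 = (d₂ + ν₂) ⊓ (d₃ + ν₃)
  m123 = (d₁ + ν₁) ⊓ m23

G : (ν₁ ν₂ ν₃ : ℕ) → Series
G ν₁ ν₂ ν₃ k d₀ d₁ d₂ d₃ =
  if k ≡ᵇ expo ν₁ ν₂ ν₃ d₁ d₂ d₃ then 1ℤ else 0ℤ

Gt : (ν₁ ν₂ ν₃ : ℕ) → Series
Gt ν₁ ν₂ ν₃ =
  oneMinusMono 1 0 0 2 2
    (oneMinusMono 1 0 1 1 1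
      (oneMinusMono 0 1 0 0 0
        (oneMinusMono 0 0 1 0 0
          (oneMinusMono 0 0 0 1 0
            (oneMinusMono 0 0 0 0 1 (G ν₁ ν₂ ν₃))))))

-- a_{ν,d}(ρ), given by its coefficient of ρ^k: the coefficient of
-- t₀^0 t₁^d₁ t₂^d₂ t₃^d₃ in G̃.
a : (ν₁ ν₂ ν₃ d₁ d₂ d₃ : ℕ) → ℕ → ℤ
a ν₁ ν₂ ν₃ d₁ d₂ d₃ k = Gt ν₁ ν₂ ν₃ k 0 d₁ d₂ d₃

-- The coefficient of ρᵏ t^d in G is 1 exactly when k = E(d), where E depends
-- only on x = d₁ + ν₁ and M = min(d₂ + ν₂, d₃ + ν₃) and is piecewise linear.
-- On each of a few cones one of the six monomials m in the prefactor of G̃ is a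
-- period of G: E(d + m) = E(d) + (ρ-degree of m).  There (1 - m) G vanishes, and
-- since the six factors commute we may apply that one first; every further
-- factor 1 - m′ merely shrinks the vanishing cone by the shift m′.  The cones
-- are: d₃ + ν₃ > d₂ + ν₂ (killed by t₃), d₂ + ν₂ > d₃ + ν₃ (t₂), x > M (t₁),
-- all degrees large (ρt₁t₂t₃, as E(d + 1) = E(d) + 1), and x well below M
-- (ρt₂²t₃², as E(d₁, d₂ + 2, d₃ + 2) = E(d) + 1); the hypothesis on d places
-- (d₁, d₂, d₃) in one of them.  Positive t₀-degree is killed by t₀, since G does
-- not depend on d₀.

module Submission where

open import Algebra.Bundles using (CommutativeMonoid)
import Algebra.Properties.CommutativeSemigroup as CommutativeSemigroupProperties
open import Data.Bool using (Bool; true; false; T; _∧_; if_then_else_)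
open import Data.Bool.Properties using (T-∧; ∧-commutativeMonoid)
open import Data.Integer as ℤ using (ℤ; 0ℤ; 1ℤ; _-_)
import Data.Integer.Properties as ℤ
open import Data.Integer.Tactic.RingSolver using (solve-∀)
open import Data.List using (List; []; _∷_; _++_; [_]; foldl)
open import Data.List.Relation.Binary.Permutation.Propositional as ↭ using (_↭_; prep; swap)
open import Data.List.Relation.Binary.Permutation.Propositional.Properties using (shift)
open import Data.List.Relation.Unary.All as All using (All; []; _∷_)
open import Data.Nat
  using (ℕ; zero; suc; _+_; _∸_; _⊓_; _≤_; _<_; _≥_; z≤n; s≤s; _≤ᵇ_; _≡ᵇ_; ⌈_/2⌉; ∣_-_∣; _≤?_; <-cmp)
open import Data.Nat.Properties
open import Data.Product using (_×_; _,_; proj₁; proj₂; ∃)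
open import Data.Sum using (_⊎_; inj₁; inj₂)
open import Data.Unit using (tt)
open import Function using (Equivalence; id; _∘_)
open import Relation.Binary.Definitions using (tri<; tri≈; tri>)
open import Relation.Binary.PropositionalEquality
  using (_≡_; refl; sym; trans; cong; cong₂; subst; subst₂; module ≡-Reasoning)
open import Relation.Nullary using (yes; no)

open import Defs

open CommutativeSemigroupProperties +-commutativeSemigroup using (xy∙z≈xz∙y; x∙yz≈xz∙y)

record Point : Set where
  constructor pt
  field
    k d₀ d₁ d₂ d₃ : ℕ

open Point

infixl 6 _⊕_ _⊖_
infix 4 _≼ᵇ_ _≈_
infixr 2 _∩_

_⊕_ : Point → Point → Point
p ⊕ q = pt (k p + k q) (d₀ p + d₀ q) (d₁ p + d₁ q) (d₂ p + d₂ q) (d₃ p + d₃ q)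

_⊖_ : Point → Point → Point
p ⊖ q = pt (k p ∸ k q) (d₀ p ∸ d₀ q) (d₁ p ∸ d₁ q) (d₂ p ∸ d₂ q) (d₃ p ∸ d₃ q)

_≼ᵇ_ : Point → Point → Bool
m ≼ᵇ p = (k m ≤ᵇ k p) ∧ (d₀ m ≤ᵇ d₀ p) ∧ (d₁ m ≤ᵇ d₁ p) ∧ (d₂ m ≤ᵇ d₂ p) ∧ (d₃ m ≤ᵇ d₃ p)

⊕-comm : ∀ p q → p ⊕ q ≡ q ⊕ p
⊕-comm p q rewrite +-comm (k p) (k q) | +-comm (d₀ p) (d₀ q) | +-comm (d₁ p) (d₁ q)
                 | +-comm (d₂ p) (d₂ q) | +-comm (d₃ p) (d₃ q) = refl

_at_ : Series → Point → ℤ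
f at p = f (k p) (d₀ p) (d₁ p) (d₂ p) (d₃ p)

_≈_ : Series → Series → Set
f ≈ g = ∀ p → f at p ≡ g at p

mulBy : Point → Series → Series
mulBy m = mulMono (k m) (d₀ m) (d₁ m) (d₂ m) (d₃ m)

oneMinus : Point → Series → Series
oneMinus m = oneMinusMono (k m) (d₀ m) (d₁ m) (d₂ m) (d₃ m)

if-∧ : ∀ {A : Set} a b (x y : A) → (if a then (if b then x else y) else y) ≡ (if a ∧ b then x else y)
if-∧ false b x y = refl
if-∧ true  b x y = refl

if-minus : ∀ c (x y : ℤ) → (if c then x - y else 0ℤ) ≡ (if c then x else 0ℤ) - (if c then y else 0ℤ)
if-minus false x y = refl
if-minus true  x y = refl

[a-b]-[c-d]≡[a-c]-[b-d] : ∀ a b c d → (a - b) - (c - d) ≡ (a - c) - (b - d)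
[a-b]-[c-d]≡[a-c]-[b-d] = solve-∀

∧-interchange : ∀ a b c d → (a ∧ b) ∧ (c ∧ d) ≡ (a ∧ c) ∧ (b ∧ d)
∧-interchange =
  CommutativeSemigroupProperties.interchange (CommutativeMonoid.commutativeSemigroup ∧-commutativeMonoid)

-- Commutation of the factors 1 - m

suc≤ᵇsuc : ∀ m n → (suc m ≤ᵇ suc n) ≡ (m ≤ᵇ n)
suc≤ᵇsuc zero    n = refl
suc≤ᵇsuc (suc m) n = refl

≤ᵇ-∸ : ∀ m n p → (m ≤ᵇ p) ∧ (n ≤ᵇ p ∸ m) ≡ (m + n ≤ᵇ p)
≤ᵇ-∸ zero    n p       = refl
≤ᵇ-∸ (suc m) n zero    = refl
≤ᵇ-∸ (suc m) n (suc p) rewrite suc≤ᵇsuc m p | suc≤ᵇsuc (m + n) p = ≤ᵇ-∸ m n p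

≼ᵇ-⊖ : ∀ m n p → (m ≼ᵇ p) ∧ (n ≼ᵇ p ⊖ m) ≡ (m ⊕ n ≼ᵇ p)
≼ᵇ-⊖ m n p =
  pairwise k (pairwise d₀ (pairwise d₁ (pairwise d₂ (≤ᵇ-∸ (d₃ m) (d₃ n) (d₃ p)))))
  where
  pairwise : ∀ (c : Point → ℕ) {A B C} → A ∧ B ≡ C →
    ((c m ≤ᵇ c p) ∧ A) ∧ ((c n ≤ᵇ c p ∸ c m) ∧ B) ≡ (c m + c n ≤ᵇ c p) ∧ C
  pairwise c {A} {B} E =
    trans (∧-interchange (c m ≤ᵇ c p) A _ B) (cong₂ _∧_ (≤ᵇ-∸ (c m) (c n) (c p)) E)

⊖-⊖ : ∀ p m n → p ⊖ m ⊖ n ≡ p ⊖ (m ⊕ n)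
⊖-⊖ p m n rewrite ∸-+-assoc (k p) (k m) (k n) | ∸-+-assoc (d₀ p) (d₀ m) (d₀ n)
  | ∸-+-assoc (d₁ p) (d₁ m) (d₁ n) | ∸-+-assoc (d₂ p) (d₂ m) (d₂ n)
  | ∸-+-assoc (d₃ p) (d₃ m) (d₃ n) = refl

mulBy-mulBy : ∀ m n f → mulBy m (mulBy n f) ≈ mulBy (m ⊕ n) f
mulBy-mulBy m n f p = trans (if-∧ (m ≼ᵇ p) (n ≼ᵇ p ⊖ m) _ 0ℤ)
  (cong₂ (λ c x → if c then x else 0ℤ) (≼ᵇ-⊖ m n p) (cong (f at_) (⊖-⊖ p m n)))

mulBy-comm : ∀ m n f → mulBy m (mulBy n f) ≈ mulBy n (mulBy m f)
mulBy-comm m n f p = trans (mulBy-mulBy m n f p)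
  (trans (cong (λ e → mulBy e f at p) (⊕-comm m n)) (sym (mulBy-mulBy n m f p)))

mulBy-oneMinus : ∀ m n f p → mulBy m (oneMinus n f) at p ≡ mulBy m f at p - mulBy m (mulBy n f) at p
mulBy-oneMinus m n f p = if-minus (m ≼ᵇ p) _ _

oneMinus-comm : ∀ m n f → oneMinus m (oneMinus n f) ≈ oneMinus n (oneMinus m f)
oneMinus-comm m n f p = begin
  oneMinus m (oneMinus n f) at p
    ≡⟨ cong (oneMinus n f at p -_) (mulBy-oneMinus m n f p) ⟩
  (f at p - mulBy n f at p) - (mulBy m f at p - mulBy m (mulBy n f) at p)
    ≡⟨ cong (λ x → (f at p - mulBy n f at p) - (mulBy m f at p - x)) (mulBy-comm m n f p) ⟩
  (f at p - mulBy n f at p) - (mulBy m f at p - mulBy n (mulBy m f) at p)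
    ≡⟨ [a-b]-[c-d]≡[a-c]-[b-d] (f at p) (mulBy n f at p) (mulBy m f at p) _ ⟩
  (f at p - mulBy m f at p) - (mulBy n f at p - mulBy n (mulBy m f) at p)
    ≡⟨ cong (oneMinus m f at p -_) (mulBy-oneMinus n m f p) ⟨
  oneMinus n (oneMinus m f) at p ∎
  where open ≡-Reasoning

oneMinus-cong : ∀ m {f g} → f ≈ g → oneMinus m f ≈ oneMinus m g
oneMinus-cong m f≈g p = cong₂ _-_ (f≈g p) (cong (λ x → if m ≼ᵇ p then x else 0ℤ) (f≈g (p ⊖ m)))

oneMinusAll : List Point → Series → Series
oneMinusAll []       f = f
oneMinusAll (m ∷ ms) f = oneMinusAll ms (oneMinus m f)

oneMinusAll-cong : ∀ ms {f g} → f ≈ g → oneMinusAll ms f ≈ oneMinusAll ms g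
oneMinusAll-cong []       f≈g = f≈g
oneMinusAll-cong (m ∷ ms) f≈g = oneMinusAll-cong ms (oneMinus-cong m f≈g)

oneMinusAll-↭ : ∀ {ms ms′} → ms ↭ ms′ → ∀ f → oneMinusAll ms f ≈ oneMinusAll ms′ f
oneMinusAll-↭ ↭.refl            f p = refl
oneMinusAll-↭ (prep m ms↭)      f   = oneMinusAll-↭ ms↭ (oneMinus m f)
oneMinusAll-↭ (swap {xs = ms} m n ms↭) f p =
  trans (oneMinusAll-cong ms (oneMinus-comm n m f) p) (oneMinusAll-↭ ms↭ _ p)
oneMinusAll-↭ (↭.trans ↭₁ ↭₂)  f p = trans (oneMinusAll-↭ ↭₁ f p) (oneMinusAll-↭ ↭₂ f p)

-- Propagating vanishing regions through the factors

Region : Set₁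
Region = Point → Set

VanishesOn : Series → Region → Set
VanishesOn f Q = ∀ p → Q p → f at p ≡ 0ℤ

if-view : ∀ {A : Set} c (x y : A) → (if c then x else y) ≡ y ⊎ T c × (if c then x else y) ≡ x
if-view false x y = inj₁ refl
if-view true  x y = inj₂ (tt , refl)

split-≤ᵇ : ∀ a b {rest} → T ((a ≤ᵇ b) ∧ rest) → a + (b ∸ a) ≡ b × T rest
split-≤ᵇ a b h = m+[n∸m]≡n (≤ᵇ⇒≤ a b (proj₁ (Equivalence.to T-∧ h))) , proj₂ (Equivalence.to T-∧ h)

pt-cong : ∀ {a a′ b₀ b₀′ b₁ b₁′ b₂ b₂′ b₃ b₃′} → a ≡ a′ → b₀ ≡ b₀′ → b₁ ≡ b₁′ → b₂ ≡ b₂′ → b₃ ≡ b₃′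
  → pt a b₀ b₁ b₂ b₃ ≡ pt a′ b₀′ b₁′ b₂′ b₃′
pt-cong refl refl refl refl refl = refl

⊕-⊖ : ∀ m p → T (m ≼ᵇ p) → m ⊕ (p ⊖ m) ≡ p
⊕-⊖ m p m≼p =
  let eₖ , m≼p₀ = split-≤ᵇ (k m) (k p) m≼p
      e₀ , m≼p₁ = split-≤ᵇ (d₀ m) (d₀ p) m≼p₀
      e₁ , m≼p₂ = split-≤ᵇ (d₁ m) (d₁ p) m≼p₁
      e₂ , d₃≤  = split-≤ᵇ (d₂ m) (d₂ p) m≼p₂
  in pt-cong eₖ e₀ e₁ e₂ (m+[n∸m]≡n (≤ᵇ⇒≤ (d₃ m) (d₃ p) d₃≤))

mulBy-view : ∀ m f p → mulBy m f at p ≡ 0ℤ ⊎ ∃ λ q → m ⊕ q ≡ p × mulBy m f at p ≡ f at q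
mulBy-view m f p with if-view (m ≼ᵇ p) (f at (p ⊖ m)) 0ℤ
... | inj₁ vanishes     = inj₁ vanishes
... | inj₂ (m≼p , eq) = inj₂ (p ⊖ m , ⊕-⊖ m p m≼p , eq)

oneMinus-vanishes : ∀ m {f P Q} → VanishesOn f P → (∀ p → Q p → P p) → (∀ q → Q (m ⊕ q) → P q)
  → VanishesOn (oneMinus m f) Q
oneMinus-vanishes m {f} f≡0 Q⊆P back p Qp with mulBy-view m f p
... | inj₁ vanishes         = cong₂ _-_ (f≡0 p (Q⊆P p Qp)) vanishes
... | inj₂ (q , refl , eq) = cong₂ _-_ (f≡0 _ (Q⊆P _ Qp)) (trans eq (f≡0 q (back q Qp)))

oneMinus-killed : ∀ m f p → f at p ≡ mulBy m f at p → oneMinus m f at p ≡ 0ℤ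
oneMinus-killed m f p = ℤ.i≡j⇒i-j≡0

-- Regions indexed by the total exponent L of the factors 1 - m applied so far.
Family : Set₁
Family = Point → Region

record Shrinks (F : Family) (m : Point) : Set where
  constructor shrinks
  field
    shrink : ∀ L p → F (L ⊕ m) p → F L p
    back   : ∀ L q → F (L ⊕ m) (m ⊕ q) → F L q

oneMinusAll-vanishes : ∀ {F} ms {f L} → All (Shrinks F) ms → VanishesOn f (F L)
  → VanishesOn (oneMinusAll ms f) (F (foldl _⊕_ L ms))
oneMinusAll-vanishes []       []                      f≡0 = f≡0
oneMinusAll-vanishes (m ∷ ms) (shrinks shrink back ∷ shs) f≡0 =
  oneMinusAll-vanishes ms shs (oneMinus-vanishes m f≡0 (shrink _) (back _))

oneMinusAll-vanishes-via : ∀ F f v xs ys → All (Shrinks F) (xs ++ ys) → VanishesOn (oneMinus v f) (F v)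
  → VanishesOn (oneMinusAll (xs ++ [ v ] ++ ys) f) (F (foldl _⊕_ v (xs ++ ys)))
oneMinusAll-vanishes-via F f v xs ys shs killed p Fp =
  trans (oneMinusAll-↭ (shift _ xs ys) f p) (oneMinusAll-vanishes (xs ++ ys) shs killed p Fp)

_∩_ : Family → Family → Family
(F ∩ H) L p = F L p × H L p

∩-shrinks : ∀ {F H m} → Shrinks F m → Shrinks H m → Shrinks (F ∩ H) m
∩-shrinks (shrinks shrinkF backF) (shrinks shrinkH backH) =
  shrinks (λ L p (f , h) → shrinkF L p f , shrinkH L p h) (λ L q (f , h) → backF L q f , backH L q h)

Fixed : Region → Family
Fixed Z L = Z

Stable : Region → Point → Set
Stable Z m = ∀ q → Z (m ⊕ q) → Z q

fixed-shrinks : ∀ {Z m} → Stable Z m → Shrinks (Fixed Z) m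
fixed-shrinks stable = shrinks (λ L p z → z) (λ L → stable)

Additive : (Point → ℕ) → Set
Additive c = ∀ p q → c (p ⊕ q) ≡ c p + c q

AtLeast : (Point → ℕ) → Family
AtLeast c L p = c L ≤ c p

atLeast-shrinks : ∀ c → Additive c → ∀ m → Shrinks (AtLeast c) m
atLeast-shrinks c additive m = shrinks
  (λ L p h → ≤-trans (m≤m+n (c L) (c m)) (subst (_≤ c p) (additive L m) h))
  (λ L q h → +-cancelʳ-≤ (c m) (c L) (c q)
    (subst₂ _≤_ (additive L m) (trans (additive m q) (+-comm (c m) (c q))) h))

bounded-shrinks : ∀ c → Additive c → ∀ {Z m} → Stable Z m → Shrinks (Fixed Z ∩ AtLeast c) m
bounded-shrinks c additive {m = m} stable =
  ∩-shrinks (fixed-shrinks stable) (atLeast-shrinks c additive m)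

-- The exponent of ρ in G

-- By definition G ν₁ ν₂ ν₃ k d₀ d₁ d₂ d₃ is δ k (expo ν₁ ν₂ ν₃ d₁ d₂ d₃), and
-- expo ν₁ ν₂ ν₃ d₁ d₂ d₃ is exponent (d₁ + ν₁) ((d₂ + ν₂) ⊓ (d₃ + ν₃)).
δ : ℕ → ℕ → ℤ
δ k e = if k ≡ᵇ e then 1ℤ else 0ℤ

exponent : ℕ → ℕ → ℕ
exponent x M = M ∸ ⌈ (M ∸ x ⊓ M) /2⌉

exponent-saturated : ∀ {x M} → M ≤ x → exponent x M ≡ M
exponent-saturated {x} {M} M≤x rewrite m≥n⇒m⊓n≡n M≤x | n∸n≡0 M = refl

exponent-suc : ∀ x M → exponent (suc x) (suc M) ≡ suc (exponent x M)
exponent-suc x M = +-∸-assoc 1 (≤-trans (⌈n/2⌉≤n _) (m∸n≤m M (x ⊓ M)))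

exponent-+2 : ∀ {x M} → x ≤ M → exponent x (2 + M) ≡ suc (exponent x M)
exponent-+2 {x} {M} x≤M = begin
  2 + M ∸ ⌈ (2 + M ∸ x ⊓ (2 + M)) /2⌉
    ≡⟨ cong (λ a → 2 + M ∸ ⌈ (2 + M ∸ a) /2⌉) (m≤n⇒m⊓n≡m (≤-trans x≤M (m≤n+m M 2))) ⟩
  2 + M ∸ ⌈ (2 + M ∸ x) /2⌉
    ≡⟨ cong (λ a → 2 + M ∸ ⌈ a /2⌉) (+-∸-assoc 2 x≤M) ⟩
  suc M ∸ ⌈ (M ∸ x) /2⌉
    ≡⟨ +-∸-assoc 1 (≤-trans (⌈n/2⌉≤n _) (m∸n≤m M x)) ⟩
  suc (M ∸ ⌈ (M ∸ x) /2⌉)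
    ≡⟨ cong (λ a → suc (M ∸ ⌈ (M ∸ a) /2⌉)) (m≤n⇒m⊓n≡m x≤M) ⟨
  suc (exponent x M) ∎
  where open ≡-Reasoning

-- Locating a large degree in one of the cones

absorb-distances : ∀ c a b ν d → c + ∣ a - ν ∣ + ∣ b - ν ∣ ≤ d → c ≤ d × c + a ≤ d + ν × c + b ≤ d + ν
absorb-distances c a b ν d h =
  ≤-trans (m≤m+n c ∣ a - ν ∣) first ,
  bound-through (m≤n+∣m-n∣ a ν) first ,
  bound-through (m≤n+∣m-n∣ b ν) (≤-trans (+-monoˡ-≤ ∣ b - ν ∣ (m≤m+n c ∣ a - ν ∣)) h)
  where
  first : c + ∣ a - ν ∣ ≤ d
  first = ≤-trans (m≤m+n (c + ∣ a - ν ∣) ∣ b - ν ∣) h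
  bound-through : ∀ {a b c d u} → a ≤ b + u → c + u ≤ d → c + a ≤ d + b
  bound-through {a} {b} {c} {d} {u} a≤b+u c+u≤d = begin
    c + a        ≤⟨ +-monoʳ-≤ c a≤b+u ⟩
    c + (b + u)  ≡⟨ x∙yz≈xz∙y c b u ⟩
    c + u + b    ≤⟨ +-monoˡ-≤ b c+u≤d ⟩
    d + b        ∎
    where open ≤-Reasoning

large-d₁-cases : ∀ d₁ d₂ d₃ ν₁ ν₂ ν₃ → 5 + ∣ ν₂ - ν₁ ∣ + ∣ ν₃ - ν₁ ∣ ≤ d₁ →
    (d₂ + ν₂) ⊓ (d₃ + ν₃) < d₁ + ν₁ × 2 ≤ d₁
  ⊎ 2 ≤ d₁ × 4 ≤ d₂ × 4 ≤ d₃
large-d₁-cases d₁ d₂ d₃ ν₁ ν₂ ν₃ h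
  with absorb-distances 5 ν₂ ν₃ ν₁ d₁ h | d₁ + ν₁ ≤? (d₂ + ν₂) ⊓ (d₃ + ν₃)
... | 5≤d₁ , _ , _ | no x≰M = inj₁ (≰⇒> x≰M , ≤-trans (m≤m+n 2 3) 5≤d₁)
... | 5≤d₁ , 5+ν₂≤x , 5+ν₃≤x | yes x≤M = inj₂ (≤-trans (m≤m+n 2 3) 5≤d₁ ,
  <⇒≤ (+-cancelʳ-≤ ν₂ 5 d₂ (≤-trans 5+ν₂≤x (≤-trans x≤M (m⊓n≤m _ _)))) ,
  <⇒≤ (+-cancelʳ-≤ ν₃ 5 d₃ (≤-trans 5+ν₃≤x (≤-trans x≤M (m⊓n≤n _ _)))))

large-d₂-cases : ∀ d₁ d₂ d₃ ν₁ ν₂ ν₃ → 7 + ∣ ν₁ - ν₂ ∣ + ∣ ν₃ - ν₂ ∣ ≤ d₂ →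
    d₃ + ν₃ < d₂ + ν₂ × 4 ≤ d₂
  ⊎ d₂ + ν₂ < d₃ + ν₃ × 4 ≤ d₃
  ⊎ 2 ≤ d₁ × 4 ≤ d₂ × 4 ≤ d₃
  ⊎ 4 ≤ d₂ × 4 ≤ d₃ × 4 + (d₁ + ν₁) ≤ d₂ + ν₂ × 4 + (d₁ + ν₁) ≤ d₃ + ν₃
large-d₂-cases d₁ d₂ d₃ ν₁ ν₂ ν₃ h
  with absorb-distances 7 ν₁ ν₃ ν₂ d₂ h | <-cmp (d₂ + ν₂) (d₃ + ν₃)
... | 7≤d₂ , _ , _ | tri> _ _ z<y = inj₁ (z<y , ≤-trans (m≤m+n 4 3) 7≤d₂)
... | _ , _ , 7+ν₃≤y | tri< y<z _ _ =
  inj₂ (inj₁ (y<z , ≤-trans (m≤m+n 4 4) (+-cancelʳ-≤ ν₃ 8 d₃ (≤-trans (s≤s 7+ν₃≤y) y<z))))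
... | 7≤d₂ , 7+ν₁≤y , 7+ν₃≤y | tri≈ _ y≡z _
  with 4 + (d₁ + ν₁) ≤? d₂ + ν₂ | +-cancelʳ-≤ ν₃ 7 d₃ (subst (7 + ν₃ ≤_) y≡z 7+ν₃≤y)
...   | yes 4+x≤y | 7≤d₃ = inj₂ (inj₂ (inj₂
  (≤-trans (m≤m+n 4 3) 7≤d₂ , ≤-trans (m≤m+n 4 3) 7≤d₃ , 4+x≤y , subst (4 + (d₁ + ν₁) ≤_) y≡z 4+x≤y)))
...   | no 4+x≰y | 7≤d₃ = inj₂ (inj₂ (inj₁ (2≤d₁ , ≤-trans (m≤m+n 4 3) 7≤d₂ , ≤-trans (m≤m+n 4 3) 7≤d₃)))
  where
  2≤d₁ : 2 ≤ d₁
  2≤d₁ = ≤-trans (m≤m+n 2 2)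
    (+-cancelˡ-≤ 4 4 d₁ (+-cancelʳ-≤ ν₁ 8 (4 + d₁) (≤-trans (s≤s 7+ν₁≤y) (≰⇒> 4+x≰y))))

t₀ t₁ t₂ t₃ ρt₁t₂t₃ ρt₂²t₃² : Point
t₀ = pt 0 1 0 0 0
t₁ = pt 0 0 1 0 0
t₂ = pt 0 0 0 1 0
t₃ = pt 0 0 0 0 1
ρt₁t₂t₃ = pt 1 0 1 1 1
ρt₂²t₃² = pt 1 0 0 2 2

module _ (ν₁ ν₂ ν₃ : ℕ) where

  x y z : Point → ℕ
  x p = d₁ p + ν₁
  y p = d₂ p + ν₂
  z p = d₃ p + ν₃

  E : ℕ → ℕ → ℕ → ℕ
  E = expo ν₁ ν₂ ν₃

  E-t₁ : ∀ d₁ d₂ d₃ → (d₂ + ν₂) ⊓ (d₃ + ν₃) ≤ d₁ + ν₁ → E (suc d₁) d₂ d₃ ≡ E d₁ d₂ d₃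
  E-t₁ d₁ d₂ d₃ M≤x = trans (exponent-saturated (≤-trans M≤x (n≤1+n _))) (sym (exponent-saturated M≤x))

  E-t₂ : ∀ d₁ d₂ d₃ → d₃ + ν₃ ≤ d₂ + ν₂ → E d₁ (suc d₂) d₃ ≡ E d₁ d₂ d₃
  E-t₂ d₁ d₂ d₃ z≤y =
    cong (exponent (d₁ + ν₁)) (trans (m≥n⇒m⊓n≡n (≤-trans z≤y (n≤1+n _))) (sym (m≥n⇒m⊓n≡n z≤y)))

  E-t₃ : ∀ d₁ d₂ d₃ → d₂ + ν₂ ≤ d₃ + ν₃ → E d₁ d₂ (suc d₃) ≡ E d₁ d₂ d₃
  E-t₃ d₁ d₂ d₃ y≤z =
    cong (exponent (d₁ + ν₁)) (trans (m≤n⇒m⊓n≡m (≤-trans y≤z (n≤1+n _))) (sym (m≤n⇒m⊓n≡m y≤z)))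

  E-ρt₁t₂t₃ : ∀ d₁ d₂ d₃ → E (suc d₁) (suc d₂) (suc d₃) ≡ suc (E d₁ d₂ d₃)
  E-ρt₁t₂t₃ d₁ d₂ d₃ = exponent-suc (d₁ + ν₁) ((d₂ + ν₂) ⊓ (d₃ + ν₃))

  E-ρt₂²t₃² : ∀ d₁ d₂ d₃ → d₁ + ν₁ ≤ d₂ + ν₂ → d₁ + ν₁ ≤ d₃ + ν₃
    → E d₁ (2 + d₂) (2 + d₃) ≡ suc (E d₁ d₂ d₃)
  E-ρt₂²t₃² d₁ d₂ d₃ x≤y x≤z = exponent-+2 (⊓-glb x≤y x≤z)

  Gν : Series
  Gν = G ν₁ ν₂ ν₃

  Margin : (Point → ℕ) → ℕ → Family
  Margin c ν L p = c L + x p ≤ c p + ν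

  margin-shrinks : ∀ c ν → Additive c → ∀ m → Shrinks (Margin c ν) m
  margin-shrinks c ν additive m = shrinks shrink back
    where
    shrink : ∀ L p → Margin c ν (L ⊕ m) p → Margin c ν L p
    shrink L p h =
      ≤-trans (+-monoˡ-≤ (x p) (≤-trans (m≤m+n (c L) (c m)) (≤-reflexive (sym (additive L m))))) h
    back : ∀ L q → Margin c ν (L ⊕ m) (m ⊕ q) → Margin c ν L q
    back L q h = +-cancelʳ-≤ (c m) _ _ (begin
      c L + x q + c m        ≡⟨ xy∙z≈xz∙y (c L) (x q) (c m) ⟩
      c L + c m + x q        ≤⟨ +-monoʳ-≤ (c L + c m) (+-monoˡ-≤ ν₁ (m≤n+m (d₁ q) (d₁ m))) ⟩
      c L + c m + x (m ⊕ q)  ≡⟨ cong (_+ x (m ⊕ q)) (additive L m) ⟨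
      c (L ⊕ m) + x (m ⊕ q)  ≤⟨ h ⟩
      c (m ⊕ q) + ν          ≡⟨ cong (_+ ν) (trans (additive m q) (+-comm (c m) (c q))) ⟩
      c q + c m + ν          ≡⟨ xy∙z≈xz∙y (c q) (c m) ν ⟩
      c q + ν + c m          ∎)
      where open ≤-Reasoning

  ThirdDominantᶠ SecondDominantᶠ FirstDominantᶠ Interiorᶠ Balancedᶠ : Family
  ThirdDominantᶠ  = Fixed (λ p → y p < z p) ∩ AtLeast d₃
  SecondDominantᶠ = Fixed (λ p → z p < y p) ∩ AtLeast d₂
  FirstDominantᶠ  = Fixed (λ p → y p ⊓ z p < x p) ∩ AtLeast d₁
  Interiorᶠ       = AtLeast d₁ ∩ AtLeast d₂ ∩ AtLeast d₃
  Balancedᶠ       = AtLeast d₂ ∩ AtLeast d₃ ∩ Margin d₂ ν₂ ∩ Margin d₃ ν₃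

  G-killed-by-t₀ : VanishesOn (oneMinus t₀ Gν) (AtLeast d₀ t₀)
  G-killed-by-t₀ p@(pt k (suc d₀) d₁ d₂ d₃) _ = oneMinus-killed t₀ Gν p refl

  G-killed-by-t₃ : VanishesOn (oneMinus t₃ Gν) (ThirdDominantᶠ t₃)
  G-killed-by-t₃ p@(pt k d₀ d₁ d₂ (suc d₃)) (y<z , _) =
    oneMinus-killed t₃ Gν p (cong (δ k) (E-t₃ d₁ d₂ d₃ (≤-pred y<z)))

  G-killed-by-t₂ : VanishesOn (oneMinus t₂ Gν) (SecondDominantᶠ t₂)
  G-killed-by-t₂ p@(pt k d₀ d₁ (suc d₂) d₃) (z<y , _) =
    oneMinus-killed t₂ Gν p (cong (δ k) (E-t₂ d₁ d₂ d₃ (≤-pred z<y)))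

  G-killed-by-t₁ : VanishesOn (oneMinus t₁ Gν) (FirstDominantᶠ t₁)
  G-killed-by-t₁ p@(pt k d₀ (suc d₁) d₂ d₃) (M<x , _) =
    oneMinus-killed t₁ Gν p (cong (δ k) (E-t₁ d₁ d₂ d₃ (≤-pred M<x)))

  -- At ρ-degree 0 the shifted term is absent and G vanishes, its ρ-exponent being positive.
  G-killed-by-ρt₁t₂t₃ : VanishesOn (oneMinus ρt₁t₂t₃ Gν) (Interiorᶠ ρt₁t₂t₃)
  G-killed-by-ρt₁t₂t₃ (pt zero d₀ (suc d₁) (suc d₂) (suc d₃)) _ =
    cong (_- 0ℤ) (cong (δ 0) (E-ρt₁t₂t₃ d₁ d₂ d₃))
  G-killed-by-ρt₁t₂t₃ p@(pt (suc k) d₀ (suc d₁) (suc d₂) (suc d₃)) _ =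
    oneMinus-killed ρt₁t₂t₃ Gν p (cong (δ (suc k)) (E-ρt₁t₂t₃ d₁ d₂ d₃))

  G-killed-by-ρt₂²t₃² : VanishesOn (oneMinus ρt₂²t₃² Gν) (Balancedᶠ ρt₂²t₃²)
  G-killed-by-ρt₂²t₃² (pt zero d₀ d₁ (suc (suc d₂)) (suc (suc d₃)))
                      (s≤s (s≤s _) , s≤s (s≤s _) , x≤y , x≤z) =
    cong (_- 0ℤ) (cong (δ 0) (E-ρt₂²t₃² d₁ d₂ d₃ (≤-pred (≤-pred x≤y)) (≤-pred (≤-pred x≤z))))
  G-killed-by-ρt₂²t₃² p@(pt (suc k) d₀ d₁ (suc (suc d₂)) (suc (suc d₃)))
                      (s≤s (s≤s _) , s≤s (s≤s _) , x≤y , x≤z) =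
    oneMinus-killed ρt₂²t₃² Gν p
      (cong (δ (suc k)) (E-ρt₂²t₃² d₁ d₂ d₃ (≤-pred (≤-pred x≤y)) (≤-pred (≤-pred x≤z))))

  ThirdDominant SecondDominant FirstDominant Interior Balanced : Region
  ThirdDominant p  = y p < z p × 4 ≤ d₃ p
  SecondDominant p = z p < y p × 4 ≤ d₂ p
  FirstDominant p  = y p ⊓ z p < x p × 2 ≤ d₁ p
  Interior p       = 2 ≤ d₁ p × 4 ≤ d₂ p × 4 ≤ d₃ p
  Balanced p       = 4 ≤ d₂ p × 4 ≤ d₃ p × 4 + x p ≤ y p × 4 + x p ≤ z p

  -- Gt ν₁ ν₂ ν₃ is oneMinusAll (t₃ ∷ t₂ ∷ t₁ ∷ t₀ ∷ ρt₁t₂t₃ ∷ ρt₂²t₃² ∷ []) Gν by definition;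
  -- each lemma below splits this list around the factor that kills Gν.
  vanishes-positive-d₀ : VanishesOn (Gt ν₁ ν₂ ν₃) (λ p → 1 ≤ d₀ p)
  vanishes-positive-d₀ =
    oneMinusAll-vanishes-via (AtLeast d₀) Gν t₀ (t₃ ∷ t₂ ∷ t₁ ∷ []) (ρt₁t₂t₃ ∷ ρt₂²t₃² ∷ [])
      (All.universal (atLeast-shrinks d₀ (λ _ _ → refl)) _) G-killed-by-t₀

  vanishes-third-dominant : VanishesOn (Gt ν₁ ν₂ ν₃) ThirdDominant
  vanishes-third-dominant =
    oneMinusAll-vanishes-via ThirdDominantᶠ Gν t₃ [] (t₂ ∷ t₁ ∷ t₀ ∷ ρt₁t₂t₃ ∷ ρt₂²t₃² ∷ [])
      (All.map (bounded-shrinks d₃ (λ _ _ → refl))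
        ((λ _ → m+n≤o⇒n≤o 1) ∷ (λ _ → id) ∷ (λ _ → id) ∷ (λ _ → ≤-pred) ∷ (λ _ → ≤-pred ∘ ≤-pred) ∷ []))
      G-killed-by-t₃

  vanishes-second-dominant : VanishesOn (Gt ν₁ ν₂ ν₃) SecondDominant
  vanishes-second-dominant =
    oneMinusAll-vanishes-via SecondDominantᶠ Gν t₂ (t₃ ∷ []) (t₁ ∷ t₀ ∷ ρt₁t₂t₃ ∷ ρt₂²t₃² ∷ [])
      (All.map (bounded-shrinks d₂ (λ _ _ → refl))
        ((λ _ → m+n≤o⇒n≤o 1) ∷ (λ _ → id) ∷ (λ _ → id) ∷ (λ _ → ≤-pred) ∷ (λ _ → ≤-pred ∘ ≤-pred) ∷ []))
      G-killed-by-t₂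

  vanishes-first-dominant : VanishesOn (Gt ν₁ ν₂ ν₃) FirstDominant
  vanishes-first-dominant =
    oneMinusAll-vanishes-via FirstDominantᶠ Gν t₁ (t₃ ∷ t₂ ∷ []) (t₀ ∷ ρt₁t₂t₃ ∷ ρt₂²t₃² ∷ [])
      (All.map (bounded-shrinks d₁ (λ _ _ → refl))
        ((λ q → ≤-trans (s≤s (⊓-monoʳ-≤ (y q) (n≤1+n (z q)))))
        ∷ (λ q → ≤-trans (s≤s (⊓-monoˡ-≤ (z q) (n≤1+n (y q)))))
        ∷ (λ _ → id) ∷ (λ _ → ≤-pred) ∷ (λ _ → m+n≤o⇒n≤o 2) ∷ []))
      G-killed-by-t₁

  vanishes-interior : VanishesOn (Gt ν₁ ν₂ ν₃) Interior
  vanishes-interior =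
    oneMinusAll-vanishes-via Interiorᶠ Gν ρt₁t₂t₃ (t₃ ∷ t₂ ∷ t₁ ∷ t₀ ∷ []) (ρt₂²t₃² ∷ [])
      (All.universal (λ m → ∩-shrinks (atLeast-shrinks d₁ (λ _ _ → refl) m)
        (∩-shrinks (atLeast-shrinks d₂ (λ _ _ → refl) m) (atLeast-shrinks d₃ (λ _ _ → refl) m))) _)
      G-killed-by-ρt₁t₂t₃

  vanishes-balanced : VanishesOn (Gt ν₁ ν₂ ν₃) Balanced
  vanishes-balanced =
    oneMinusAll-vanishes-via Balancedᶠ Gν ρt₂²t₃² (t₃ ∷ t₂ ∷ t₁ ∷ t₀ ∷ ρt₁t₂t₃ ∷ []) []
      (All.universal (λ m → ∩-shrinks (atLeast-shrinks d₂ (λ _ _ → refl) m)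
        (∩-shrinks (atLeast-shrinks d₃ (λ _ _ → refl) m)
          (∩-shrinks (margin-shrinks d₂ ν₂ (λ _ _ → refl) m) (margin-shrinks d₃ ν₃ (λ _ _ → refl) m)))) _)
      G-killed-by-ρt₂²t₃²

  LargeDegree : Region
  LargeDegree p = (d₁ p ≥ 5 + ∣ ν₂ - ν₁ ∣ + ∣ ν₃ - ν₁ ∣)
                ⊎ (d₂ p ≥ 7 + ∣ ν₁ - ν₂ ∣ + ∣ ν₃ - ν₂ ∣)
                ⊎ (d₃ p ≥ 7 + ∣ ν₁ - ν₃ ∣ + ∣ ν₂ - ν₃ ∣)

  vanishes-large-degree : VanishesOn (Gt ν₁ ν₂ ν₃) LargeDegree
  vanishes-large-degree p (inj₁ h) with large-d₁-cases (d₁ p) (d₂ p) (d₃ p) ν₁ ν₂ ν₃ h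
  ... | inj₁ r = vanishes-first-dominant p r
  ... | inj₂ r = vanishes-interior p r
  vanishes-large-degree p (inj₂ (inj₁ h)) with large-d₂-cases (d₁ p) (d₂ p) (d₃ p) ν₁ ν₂ ν₃ h
  ... | inj₁ r               = vanishes-second-dominant p r
  ... | inj₂ (inj₁ r)        = vanishes-third-dominant p r
  ... | inj₂ (inj₂ (inj₁ r)) = vanishes-interior p r
  ... | inj₂ (inj₂ (inj₂ r)) = vanishes-balanced p r
  vanishes-large-degree p (inj₂ (inj₂ h)) with large-d₂-cases (d₁ p) (d₃ p) (d₂ p) ν₁ ν₃ ν₂ h
  ... | inj₁ r                              = vanishes-third-dominant p r
  ... | inj₂ (inj₁ r)                       = vanishes-second-dominant p r
  ... | inj₂ (inj₂ (inj₁ (a , b , c)))      = vanishes-interior p (a , c , b)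
  ... | inj₂ (inj₂ (inj₂ (a , b , c , d))) = vanishes-balanced p (b , a , d , c)

mainTheorem6 : (ν₁ ν₂ ν₃ : ℕ)
    → ((k d₀ d₁ d₂ d₃ : ℕ) → Gt ν₁ ν₂ ν₃ k (suc d₀) d₁ d₂ d₃ ≡ 0ℤ)
      × ((d₁ d₂ d₃ : ℕ)
         → (d₁ ≥ 5 + ∣ ν₂ - ν₁ ∣ + ∣ ν₃ - ν₁ ∣)
           ⊎ (d₂ ≥ 7 + ∣ ν₁ - ν₂ ∣ + ∣ ν₃ - ν₂ ∣)
           ⊎ (d₃ ≥ 7 + ∣ ν₁ - ν₃ ∣ + ∣ ν₂ - ν₃ ∣)
         → (k : ℕ) → a ν₁ ν₂ ν₃ d₁ d₂ d₃ k ≡ 0ℤ)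
mainTheorem6 ν₁ ν₂ ν₃ =
  (λ k d₀ d₁ d₂ d₃ → vanishes-positive-d₀ ν₁ ν₂ ν₃ (pt k (suc d₀) d₁ d₂ d₃) (s≤s z≤n)) ,
  (λ d₁ d₂ d₃ large k → vanishes-large-degree ν₁ ν₂ ν₃ (pt k 0 d₁ d₂ d₃) large)
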